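{- Let $m\ge 1$. Define integers $f_n^{(m)}$ by $f_n^{(m)}=0$ for $n<0$, $f_0^{(m)}=f_1^{(m)}=1$, and $f_n^{(m)}=2f_{n-1}^{(m)}-f_{n-m-1}^{(m)}$ for $n\ge 2$. Then for every integer $n\ge 0$, $$\sum_{\substack{k\ge 0\\ m\,\mid\, n+k}}\binom{(n+k)/m}{k}_m 2^{ -k/m}=2^{1+\frac{n}{m}}f_n^{(m)}.$$
   Context: Let $p_m(t)=1+t+\cdots+t^m$. For integers $N\ge 0$ and $k\ge 0$, $\binom{N}{k}_m$ is the coefficient of $t^k$ in $p_m(t)^N$ (so it is $0$ if $k>mN$). -}

module Defs where

open import Data.Nat as ℕ using (ℕ; zero; suc; _+_; _*_)
open import Data.Nat.Divisibility using (_∣_; _∣?_; quotient)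
open import Data.List using (List; []; _∷_; map; replicate)
open import Data.Integer as ℤ using (ℤ; +_)
open import Data.Rational as ℚ using (ℚ; ½; 0ℚ; 1ℚ; _<_; ∣_∣)
open import Data.Product using (∃)
open import Relation.Nullary using (yes; no)

-- Polynomials with natural-number coefficients, as coefficient lists
-- (index i = coefficient of t^i).
Poly : Set
Poly = List ℕ

_⊕_ : Poly → Poly → Poly
[] ⊕ q = q
(a ∷ p) ⊕ [] = a ∷ p
(a ∷ p) ⊕ (b ∷ q) = (a + b) ∷ (p ⊕ q)

_⊛_ : Poly → Poly → Poly
[] ⊛ q = []
(a ∷ p) ⊛ q = map (a *_) q ⊕ (0 ∷ (p ⊛ q))

polyPow : Poly → ℕ → Poly
polyPow p zero = 1 ∷ []
polyPow p (suc N) = p ⊛ polyPow p N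

coeff : Poly → ℕ → ℕ
coeff [] k = 0
coeff (a ∷ p) zero = a
coeff (a ∷ p) (suc k) = coeff p k

pm : ℕ → Poly
pm m = replicate (suc m) 1

binom : ℕ → ℕ → ℕ → ℕ
binom m N k = coeff (polyPow (pm m) N) k

-- The sequence f^{(m)}: fList m n = [f_n, f_{n-1}, ..., f_0].
headOr0 : List ℤ → ℤ
headOr0 [] = + 0
headOr0 (x ∷ _) = x

-- l !0 i = i-th entry, or 0 if out of range (encodes f_j = 0 for j < 0)
_!0_ : List ℤ → ℕ → ℤ
[] !0 i = + 0
(x ∷ l) !0 zero = x
(x ∷ l) !0 suc i = l !0 i

fList : ℕ → ℕ → List ℤ
fList m zero = + 1 ∷ []
fList m (suc zero) = + 1 ∷ + 1 ∷ []
fList m (suc (suc n)) =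
  let l = fList m (suc n)
  -- l !0 0 = f_{n+1}, l !0 m = f_{n+1-m} (= 0 if n+1-m < 0)
  in ((+ 2) ℤ.* headOr0 l ℤ.- (l !0 m)) ∷ l

f : ℕ → ℕ → ℤ
f m n = headOr0 (fList m n)

halfPow : ℕ → ℚ
halfPow zero = 1ℚ
halfPow (suc q) = ½ ℚ.* halfPow q

-- Scaled k-th term: the paper's summand divided by 2^{n/m}.
-- If m ∣ n+k with N = (n+k)/m then 2^{-k/m} = 2^{n/m} * 2^{-N}, so the
-- paper's term equals 2^{n/m} * binom m N k * (1/2)^N.
term : ℕ → ℕ → ℕ → ℚ
term m n k with m ∣? (n + k)
... | yes d = ((+ binom m (quotient d) k) ℚ./ 1) ℚ.* halfPow (quotient d)
... | no _ = 0ℚ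

partialSum : (ℕ → ℚ) → ℕ → ℚ
partialSum a zero = 0ℚ
partialSum a (suc K) = partialSum a K ℚ.+ a K

SeriesConvergesTo : (ℕ → ℚ) → ℚ → Set
SeriesConvergesTo a L =
  (ε : ℚ) → 0ℚ < ε → ∃ λ M → (K : ℕ) → M ℕ.≤ K → ∣ partialSum a K ℚ.- L ∣ < ε

{-# OPTIONS --safe #-}
-- After division by 2^{n/m} the term of the series with n + k = N m is binom_m(N, k) 2^{-N}, and since p_m^N
-- is palindromic of degree N m this equals binom_m(N, n) 2^{-N}.  So the partial sums run through
-- S_J(n) = Σ_{j<J} binom_m(j, n) 2^{-j}, and it remains to show S_J(n) → L(n) := 2 f_n.
-- Multiplying by p_m gives S_{J+1}(d) = [d = 0] + ½ Σ_{i≤m} S_J(d − i), and since the recurrence for f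
-- amounts to f_{d+1} = f_d + ⋯ + f_{d+1−m}, L satisfies the same equation L(d) = [d = 0] + ½ Σ_{i≤m} L(d − i).
-- So the error E_J = L − S_J obeys E_{J+1}(d) = ½ (E_J(d) + Σ_{1≤i≤m} E_J(d − i)); it is nonnegative and
-- bounded by L(d), and tends to 0 by induction on d: the sum tends to 0 by hypothesis, and a bounded
-- sequence that is halved at every step up to a null perturbation is null.

module Submission where

open import Defs
open import Algebra.Bundles using (CommutativeMonoid)
open import Algebra.Structures using (IsCommutativeMonoid)
open import Data.Nat as ℕ using (ℕ; zero; suc; z≤n; s≤s)
import Data.Nat.Properties as ℕP
import Data.Integer.Properties as ℤP
import Data.Rational.Properties as ℚP
open import Relation.Binary.PropositionalEquality hiding (J)

module Window {A : Set} {_∙_ : A → A → A} {ε : A} (isCM : IsCommutativeMonoid _≡_ _∙_ ε) where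

  open import Data.Nat using (_+_; _≤_; _<_)
  open IsCommutativeMonoid isCM using (assoc; comm; identityʳ; identityˡ)

  private
    commutativeMonoid : CommutativeMonoid _ _
    commutativeMonoid = record { isCommutativeMonoid = isCM }

  open import Algebra.Properties.CommutativeSemigroup
    (CommutativeMonoid.commutativeSemigroup commutativeMonoid) using (interchange)

  shift : ℕ → (ℕ → A) → ℕ → A
  shift zero G d = G d
  shift (suc i) G zero = ε
  shift (suc i) G (suc d) = shift i G d

  -- window m G d = G d ∙ G (d − 1) ∙ ⋯ ∙ G (d − m), reading G as ε at negative arguments:
  -- the coefficients of p_m(t) · Σ_e G e tᵉ.
  window : ℕ → (ℕ → A) → ℕ → A
  window zero G d = G d
  window (suc m) G d = window m G d ∙ shift (suc m) G d

  window-at-0 : ∀ m G → window m G 0 ≡ G 0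
  window-at-0 zero G = refl
  window-at-0 (suc m) G = trans (identityʳ (window m G 0)) (window-at-0 m G)

  window-suc-suc : ∀ m G d → window (suc m) G (suc d) ≡ G (suc d) ∙ window m G d
  window-suc-suc zero G d = refl
  window-suc-suc (suc m) G d =
    trans (cong (_∙ shift (suc m) G d) (window-suc-suc m G d)) (assoc _ _ _)

  window-slide : ∀ m G d → window m G (suc d) ∙ shift m G d ≡ G (suc d) ∙ window m G d
  window-slide zero G d = refl
  window-slide (suc m) G d = window-suc-suc (suc m) G d

  VanishesAbove : ℕ → (ℕ → A) → Set
  VanishesAbove c G = ∀ e → c < e → G e ≡ ε

  shift-vanishesAbove : ∀ {c G} → VanishesAbove c G → ∀ i → VanishesAbove (i + c) (shift i G)
  shift-vanishesAbove G↑ zero = G↑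
  shift-vanishesAbove G↑ (suc i) zero ()
  shift-vanishesAbove G↑ (suc i) (suc e) (s≤s i+c<e) = shift-vanishesAbove G↑ i e i+c<e

  window-vanishesAbove : ∀ {c G} → VanishesAbove c G → ∀ m → VanishesAbove (m + c) (window m G)
  window-vanishesAbove G↑ zero = G↑
  window-vanishesAbove {c} {G} G↑ (suc m) e m+c<e = begin
    window m G e ∙ shift (suc m) G e ≡⟨ cong₂ _∙_ (window-vanishesAbove G↑ m e m+c<e′)
                                                 (shift-vanishesAbove G↑ (suc m) e m+c<e) ⟩
    ε ∙ ε                            ≡⟨ identityʳ ε ⟩
    ε                                ∎
    where
    open ≡-Reasoning
    m+c<e′ : m + c < e
    m+c<e′ = ℕP.<-trans (ℕP.n<1+n (m + c)) m+c<e

  record Palindromic (c : ℕ) (G : ℕ → A) : Set where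
    field
      vanishesAbove : VanishesAbove c G
      mirror        : ∀ x y → x + y ≡ c → G x ≡ G y

  module _ {c G} (P : Palindromic c G) where
    open Palindromic P

    shift-mirror : ∀ i x y → x + y ≡ i + c → G x ≡ shift i G y
    shift-mirror zero x y eq = mirror x y eq
    shift-mirror (suc i) x zero eq =
      vanishesAbove x (ℕP.≤-trans (s≤s (ℕP.m≤n+m c i)) (ℕP.≤-reflexive (trans (sym eq) (ℕP.+-identityʳ x))))
    shift-mirror (suc i) x (suc y) eq = shift-mirror i x y (ℕP.suc-injective (trans (sym (ℕP.+-suc x y)) eq))

    window-mirror : ∀ m x y → x + y ≡ m + c → window m G x ≡ window m G y
    window-mirror zero x y eq = mirror x y eq
    window-mirror (suc m) zero y eq = begin
      window (suc m) G 0               ≡⟨ window-at-0 (suc m) G ⟩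
      G 0                              ≡⟨ shift-mirror (suc m) 0 y eq ⟩
      shift (suc m) G y                ≡⟨ identityˡ _ ⟨
      ε ∙ shift (suc m) G y            ≡⟨ cong (_∙ shift (suc m) G y) window≡ε ⟨
      window m G y ∙ shift (suc m) G y ∎
      where
      open ≡-Reasoning
      window≡ε : window m G y ≡ ε
      window≡ε = window-vanishesAbove vanishesAbove m y (ℕP.≤-reflexive (sym eq))
    window-mirror (suc m) (suc x) y eq = begin
      window (suc m) G (suc x)         ≡⟨ window-suc-suc m G x ⟩
      G (suc x) ∙ window m G x         ≡⟨ cong₂ _∙_ (shift-mirror (suc m) (suc x) y eq)
                                                    (window-mirror m x y (ℕP.suc-injective eq)) ⟩
      shift (suc m) G y ∙ window m G y ≡⟨ comm _ _ ⟩
      window m G y ∙ shift (suc m) G y ∎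
      where open ≡-Reasoning

  palindromic-cong : ∀ {c G H} → (∀ e → G e ≡ H e) → Palindromic c G → Palindromic c H
  palindromic-cong G≗H P = record
    { vanishesAbove = λ e c<e → trans (sym (G≗H e)) (vanishesAbove e c<e)
    ; mirror        = λ x y eq → trans (sym (G≗H x)) (trans (mirror x y eq) (G≗H y))
    }
    where open Palindromic P

  window-palindromic : ∀ {c G} → Palindromic c G → ∀ m → Palindromic (m + c) (window m G)
  window-palindromic P m = record
    { vanishesAbove = window-vanishesAbove (Palindromic.vanishesAbove P) m
    ; mirror        = window-mirror P m
    }

  window-preserves : (P : A → Set) → (∀ {x y} → P x → P y → P (x ∙ y)) →
                     ∀ m G d → (∀ e → e ≤ d → P (G e)) → P (window m G d)
  window-preserves P P-∙ zero G d PG = PG d ℕP.≤-refl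
  window-preserves P P-∙ (suc m) G zero PG = subst P (sym (window-at-0 (suc m) G)) (PG 0 z≤n)
  window-preserves P P-∙ (suc m) G (suc d) PG = subst P (sym (window-suc-suc m G d))
    (P-∙ (PG (suc d) ℕP.≤-refl) (window-preserves P P-∙ m G d (λ e e≤d → PG e (ℕP.m≤n⇒m≤1+n e≤d))))

  window-∙ : ∀ m G H d → window m (λ e → G e ∙ H e) d ≡ window m G d ∙ window m H d
  window-∙ zero G H d = refl
  window-∙ (suc m) G H zero = begin
    window (suc m) (λ e → G e ∙ H e) 0 ≡⟨ window-at-0 (suc m) _ ⟩
    G 0 ∙ H 0                          ≡⟨ cong₂ _∙_ (window-at-0 (suc m) G) (window-at-0 (suc m) H) ⟨
    window (suc m) G 0 ∙ window (suc m) H 0 ∎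
    where open ≡-Reasoning
  window-∙ (suc m) G H (suc d) = begin
    window (suc m) (λ e → G e ∙ H e) (suc d)              ≡⟨ window-suc-suc m _ d ⟩
    (G (suc d) ∙ H (suc d)) ∙ window m (λ e → G e ∙ H e) d ≡⟨ cong (_ ∙_) (window-∙ m G H d) ⟩
    (G (suc d) ∙ H (suc d)) ∙ (window m G d ∙ window m H d) ≡⟨ interchange _ _ _ _ ⟩
    (G (suc d) ∙ window m G d) ∙ (H (suc d) ∙ window m H d)
                                    ≡⟨ cong₂ _∙_ (window-suc-suc m G d) (window-suc-suc m H d) ⟨
    window (suc m) G (suc d) ∙ window (suc m) H (suc d)    ∎
    where open ≡-Reasoning

module _ {A B : Set} {_∙_ : A → A → A} {ε : A} {_∙′_ : B → B → B} {ε′ : B}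
         (M : IsCommutativeMonoid _≡_ _∙_ ε) (N : IsCommutativeMonoid _≡_ _∙′_ ε′) where

  private
    module WA = Window M
    module WB = Window N

  window-map : (g : A → B) → (∀ x y → g (x ∙ y) ≡ g x ∙′ g y) →
               ∀ m G d → g (WA.window m G d) ≡ WB.window m (λ e → g (G e)) d
  window-map g g-∙ zero G d = refl
  window-map g g-∙ (suc m) G zero =
    trans (cong g (WA.window-at-0 (suc m) G)) (sym (WB.window-at-0 (suc m) _))
  window-map g g-∙ (suc m) G (suc d) = begin
    g (WA.window (suc m) G (suc d))                ≡⟨ cong g (WA.window-suc-suc m G d) ⟩
    g (G (suc d) ∙ WA.window m G d)                ≡⟨ g-∙ _ _ ⟩
    g (G (suc d)) ∙′ g (WA.window m G d)           ≡⟨ cong (_ ∙′_) (window-map g g-∙ m G d) ⟩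
    g (G (suc d)) ∙′ WB.window m (λ e → g (G e)) d ≡⟨ WB.window-suc-suc m _ d ⟨
    WB.window (suc m) (λ e → g (G e)) (suc d)      ∎
    where open ≡-Reasoning

module ℕW = Window ℕP.+-0-isCommutativeMonoid
module ℤW = Window ℤP.+-0-isCommutativeMonoid
module ℚW = Window ℚP.+-0-isCommutativeMonoid

module Coefficients where

  open import Data.Nat using (_+_; _*_)
  open import Data.List using ([]; _∷_; map)

  coeff-⊕ : ∀ p q k → coeff (p ⊕ q) k ≡ coeff p k + coeff q k
  coeff-⊕ [] q k = refl
  coeff-⊕ (a ∷ p) [] k = sym (ℕP.+-identityʳ _)
  coeff-⊕ (a ∷ p) (b ∷ q) zero = refl
  coeff-⊕ (a ∷ p) (b ∷ q) (suc k) = coeff-⊕ p q k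

  coeff-map-* : ∀ a q k → coeff (map (a *_) q) k ≡ a * coeff q k
  coeff-map-* a [] k = sym (ℕP.*-zeroʳ a)
  coeff-map-* a (b ∷ q) zero = refl
  coeff-map-* a (b ∷ q) (suc k) = coeff-map-* a q k

  coeff-⊛-cons : ∀ a p q k → coeff ((a ∷ p) ⊛ q) k ≡ a * coeff q k + coeff (0 ∷ (p ⊛ q)) k
  coeff-⊛-cons a p q k = trans (coeff-⊕ (map (a *_) q) (0 ∷ (p ⊛ q)) k) (cong (_+ _) (coeff-map-* a q k))

  coeff-pm-⊛ : ∀ m q k → coeff (pm m ⊛ q) k ≡ ℕW.window m (coeff q) k
  coeff-pm-⊛ zero q k = begin
    coeff (pm 0 ⊛ q) k              ≡⟨ coeff-⊛-cons 1 [] q k ⟩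
    1 * coeff q k + coeff (0 ∷ []) k ≡⟨ cong₂ _+_ (ℕP.*-identityˡ (coeff q k)) (coeff-single-0 k) ⟩
    coeff q k + 0                    ≡⟨ ℕP.+-identityʳ _ ⟩
    coeff q k                        ∎
    where
    open ≡-Reasoning
    coeff-single-0 : ∀ k → coeff (0 ∷ []) k ≡ 0
    coeff-single-0 zero = refl
    coeff-single-0 (suc k) = refl
  coeff-pm-⊛ (suc m) q zero = begin
    coeff (pm (suc m) ⊛ q) 0 ≡⟨ coeff-⊛-cons 1 (pm m) q 0 ⟩
    1 * coeff q 0 + 0        ≡⟨ ℕP.+-identityʳ _ ⟩
    1 * coeff q 0            ≡⟨ ℕP.*-identityˡ _ ⟩
    coeff q 0                ≡⟨ ℕW.window-at-0 (suc m) (coeff q) ⟨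
    ℕW.window (suc m) (coeff q) 0 ∎
    where open ≡-Reasoning
  coeff-pm-⊛ (suc m) q (suc k) = begin
    coeff (pm (suc m) ⊛ q) (suc k)                ≡⟨ coeff-⊛-cons 1 (pm m) q (suc k) ⟩
    1 * coeff q (suc k) + coeff (pm m ⊛ q) k       ≡⟨ cong₂ _+_ (ℕP.*-identityˡ _) (coeff-pm-⊛ m q k) ⟩
    coeff q (suc k) + ℕW.window m (coeff q) k      ≡⟨ ℕW.window-suc-suc m (coeff q) k ⟨
    ℕW.window (suc m) (coeff q) (suc k)            ∎
    where open ≡-Reasoning

  binom-suc : ∀ m j k → binom m (suc j) k ≡ ℕW.window m (binom m j) k
  binom-suc m j = coeff-pm-⊛ m (polyPow (pm m) j)

  binom-palindromic : ∀ m j → ℕW.Palindromic (j * m) (binom m j)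
  binom-palindromic m zero = record { vanishesAbove = vanishes ; mirror = mirror }
    where
    vanishes : ℕW.VanishesAbove 0 (binom m 0)
    vanishes (suc e) _ = refl
    mirror : ∀ x y → x + y ≡ 0 → binom m 0 x ≡ binom m 0 y
    mirror zero zero _ = refl
  binom-palindromic m (suc j) =
    ℕW.palindromic-cong (λ e → sym (binom-suc m j e)) (ℕW.window-palindromic (binom-palindromic m j) m)

module Recurrence where

  open import Data.Nat using (_<_)
  open import Data.Nat.Induction using (<-rec)
  open import Data.Integer as ℤ using (+_)
  import Data.Integer.Tactic.RingSolver as ZR
  open import Data.List using (_∷_)

  fList-suc : ∀ m n → fList m (suc n) ≡ f m (suc n) ∷ fList m n
  fList-suc m zero = refl
  fList-suc m (suc n) = refl

  fList-!0 : ∀ m n i → fList m n !0 i ≡ ℤW.shift i (f m) n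
  fList-!0 m zero zero = refl
  fList-!0 m zero (suc i) = refl
  fList-!0 m (suc n) i rewrite fList-suc m n with i
  ... | zero = refl
  ... | suc i = fList-!0 m n i

  f-suc-suc : ∀ m n → f m (suc (suc n)) ≡ + 2 ℤ.* f m (suc n) ℤ.- ℤW.shift m (f m) (suc n)
  f-suc-suc m n = cong (λ x → + 2 ℤ.* f m (suc n) ℤ.- x) (fList-!0 m (suc n) m)

  f-suc : ∀ m′ d → f (suc m′) (suc d) ≡ ℤW.window m′ (f (suc m′)) d
  f-suc m′ zero = sym (ℤW.window-at-0 m′ (f (suc m′)))
  f-suc m′ (suc d) = begin
    f m (suc (suc d))                  ≡⟨ f-suc-suc m d ⟩
    + 2 ℤ.* x ℤ.- s                    ≡⟨ double-minus x s ⟩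
    (x ℤ.+ x) ℤ.- s                    ≡⟨ cong (λ y → (x ℤ.+ y) ℤ.- s) (f-suc m′ d) ⟩
    (x ℤ.+ ℤW.window m′ (f m) d) ℤ.- s ≡⟨ cong (ℤ._- s) (ℤW.window-slide m′ (f m) d) ⟨
    (w ℤ.+ s) ℤ.- s                    ≡⟨ add-sub w s ⟩
    w                                  ∎
    where
    open ≡-Reasoning
    m = suc m′
    x = f m (suc d)
    s = ℤW.shift m′ (f m) d
    w = ℤW.window m′ (f m) (suc d)
    double-minus : ∀ x s → + 2 ℤ.* x ℤ.- s ≡ (x ℤ.+ x) ℤ.- s
    double-minus = ZR.solve-∀
    add-sub : ∀ x s → (x ℤ.+ s) ℤ.- s ≡ x
    add-sub = ZR.solve-∀

  f-nonNegative : ∀ m′ d → + 0 ℤ.≤ f (suc m′) d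
  f-nonNegative m′ = <-rec (λ d → + 0 ℤ.≤ f (suc m′) d) nonNeg
    where
    nonNeg : ∀ d → (∀ {e} → e < d → + 0 ℤ.≤ f (suc m′) e) → + 0 ℤ.≤ f (suc m′) d
    nonNeg zero _ = ℤ.+≤+ z≤n
    nonNeg (suc d) below = subst (+ 0 ℤ.≤_) (sym (f-suc m′ d))
      (ℤW.window-preserves (+ 0 ℤ.≤_) ℤP.+-mono-≤ m′ (f (suc m′)) d (λ e e≤d → below (s≤s e≤d)))

module Embedding where

  open import Data.Integer as ℤ using (ℤ; +_)
  open import Data.Rational as ℚ using (ℚ; mkℚ; _/_)
  open import Data.Rational.Unnormalised as U using (mkℚᵘ; *≡*)
  import Data.Rational.Unnormalised.Properties as UP

  ι : ℤ → ℚ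
  ι i = i / 1

  toℚᵘ-ι : ∀ i → ℚ.toℚᵘ (ι i) U.≃ mkℚᵘ i 0
  toℚᵘ-ι i = ℚP.toℚᵘ-fromℚᵘ (mkℚᵘ i 0)

  ι-+ : ∀ i j → ι (i ℤ.+ j) ≡ ι i ℚ.+ ι j
  ι-+ i j = ℚP.toℚᵘ-injective (begin
    ℚ.toℚᵘ (ι (i ℤ.+ j))               ≈⟨ toℚᵘ-ι (i ℤ.+ j) ⟩
    mkℚᵘ (i ℤ.+ j) 0                   ≈⟨ *≡* (cong (ℤ._* + 1) (cong₂ ℤ._+_ (ℤP.*-identityʳ i)
                                                                            (ℤP.*-identityʳ j))) ⟨
    mkℚᵘ i 0 U.+ mkℚᵘ j 0              ≈⟨ UP.+-cong (toℚᵘ-ι i) (toℚᵘ-ι j) ⟨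
    ℚ.toℚᵘ (ι i) U.+ ℚ.toℚᵘ (ι j)      ≈⟨ ℚP.toℚᵘ-homo-+ (ι i) (ι j) ⟨
    ℚ.toℚᵘ (ι i ℚ.+ ι j)               ∎)
    where open UP.≃-Reasoning

  ι-* : ∀ i j → ι (i ℤ.* j) ≡ ι i ℚ.* ι j
  ι-* i j = ℚP.toℚᵘ-injective (begin
    ℚ.toℚᵘ (ι (i ℤ.* j))               ≈⟨ toℚᵘ-ι (i ℤ.* j) ⟩
    mkℚᵘ i 0 U.* mkℚᵘ j 0              ≈⟨ UP.*-cong (toℚᵘ-ι i) (toℚᵘ-ι j) ⟨
    ℚ.toℚᵘ (ι i) U.* ℚ.toℚᵘ (ι j)      ≈⟨ ℚP.toℚᵘ-homo-* (ι i) (ι j) ⟨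
    ℚ.toℚᵘ (ι i ℚ.* ι j)               ∎)
    where open UP.≃-Reasoning

  ι-mono-≤ : ∀ {i j} → i ℤ.≤ j → ι i ℚ.≤ ι j
  ι-mono-≤ {i} {j} i≤j = ℚP.toℚᵘ-cancel-≤
    (UP.≤-respˡ-≃ (UP.≃-sym (toℚᵘ-ι i)) (UP.≤-respʳ-≃ (UP.≃-sym (toℚᵘ-ι j))
      (U.*≤* (ℤP.*-monoʳ-≤-nonNeg (+ 1) i≤j))))

  ι-nonNeg : ∀ n → ℚ.0ℚ ℚ.≤ ι (+ n)
  ι-nonNeg n = ι-mono-≤ {+ 0} {+ n} (ℤ.+≤+ z≤n)

  ι-mono-< : ∀ {i j} → i ℤ.< j → ι i ℚ.< ι j
  ι-mono-< {i} {j} i<j = ℚP.toℚᵘ-cancel-<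
    (UP.<-respˡ-≃ (UP.≃-sym (toℚᵘ-ι i)) (UP.<-respʳ-≃ (UP.≃-sym (toℚᵘ-ι j))
      (U.*<* (ℤP.*-monoʳ-<-pos (+ 1) i<j))))

  ι-ℕ-* : ∀ m n → ι (+ (m ℕ.* n)) ≡ ι (+ m) ℚ.* ι (+ n)
  ι-ℕ-* m n = trans (cong ι (ℤP.pos-* m n)) (ι-* (+ m) (+ n))

  *-denominator : ∀ p → p ℚ.* ι (ℚ.↧ p) ≡ ι (ℚ.↥ p)
  *-denominator p@(mkℚ n d _) = ℚP.toℚᵘ-injective (begin
    ℚ.toℚᵘ (p ℚ.* ι (+ suc d))            ≈⟨ ℚP.toℚᵘ-homo-* p (ι (+ suc d)) ⟩
    mkℚᵘ n d U.* ℚ.toℚᵘ (ι (+ suc d))     ≈⟨ UP.*-cong (UP.≃-refl {mkℚᵘ n d}) (toℚᵘ-ι (+ suc d)) ⟩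
    mkℚᵘ n d U.* mkℚᵘ (+ suc d) 0         ≈⟨ *≡* (trans (ℤP.*-identityʳ _)
                                                 (cong (n ℤ.*_) (cong +_ (sym (ℕP.*-identityʳ (suc d)))))) ⟩
    mkℚᵘ n 0                              ≈⟨ toℚᵘ-ι n ⟨
    ℚ.toℚᵘ (ι n)                          ∎)
    where open UP.≃-Reasoning

module Null where

  open import Data.Nat using (_^_)
  open import Data.Integer as ℤ using (+_; +[1+_]; +0; -[1+_])
  open import Data.Rational using (ℚ; mkℚ; 0ℚ; 1ℚ; ½; _+_; _*_; _<_; _≤_; nonNegative; positive)
  open import Data.Rational.Solver using (module +-*-Solver)
  open import Data.Product using (∃; _,_; proj₁; proj₂)
  open import Relation.Nullary.Decidable using (toWitness)
  open import Data.Empty using (⊥-elim)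
  open Embedding

  -- Only an upper bound is asked for: Null is applied to nonnegative sequences.
  Null : (ℕ → ℚ) → Set
  Null u = ∀ ε → 0ℚ < ε → ∃ λ M → ∀ J → M ℕ.≤ J → u J < ε

  null-cong : ∀ {u v} → (∀ J → u J ≡ v J) → Null u → Null v
  null-cong u≗v u→0 ε ε>0 with u→0 ε ε>0
  ... | M , below = M , λ J M≤J → subst (_< ε) (u≗v J) (below J M≤J)

  ½-pos : 0ℚ < ½
  ½-pos = toWitness {a? = 0ℚ ℚP.<? ½} _

  halves : ∀ ε → ½ * ε + ½ * ε ≡ ε
  halves = solve 1 (λ ε → con ½ :* ε :+ con ½ :* ε := ε) refl
    where open +-*-Solver

  *-pos : ∀ {p q} → 0ℚ < p → 0ℚ < q → 0ℚ < p * q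
  *-pos {p} {q} p>0 q>0 = ℚP.positive⁻¹ (p * q) {{ℚP.pos*pos⇒pos p {{positive p>0}} q {{positive q>0}}}}

  *-nonNeg : ∀ {p q} → 0ℚ ≤ p → 0ℚ ≤ q → 0ℚ ≤ p * q
  *-nonNeg {p} {q} p≥0 q≥0 =
    ℚP.nonNegative⁻¹ (p * q) {{ℚP.nonNeg*nonNeg⇒nonNeg p {{nonNegative p≥0}} q {{nonNegative q≥0}}}}

  half-pos : ∀ {ε} → 0ℚ < ε → 0ℚ < ½ * ε
  half-pos = *-pos ½-pos

  null-0 : Null (λ _ → 0ℚ)
  null-0 ε ε>0 = 0 , λ _ _ → ε>0

  null-+ : ∀ {u v} → Null u → Null v → Null (λ J → u J + v J)
  null-+ {u} {v} u→0 v→0 ε ε>0 with u→0 (½ * ε) (half-pos ε>0) | v→0 (½ * ε) (half-pos ε>0)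
  ... | Mu , u< | Mv , v< = Mu ℕ.⊔ Mv , λ J le → subst (u J + v J <_) (halves ε)
    (ℚP.+-mono-< (u< J (ℕP.≤-trans (ℕP.m≤m⊔n Mu Mv) le)) (v< J (ℕP.≤-trans (ℕP.m≤n⊔m Mu Mv) le)))

  archimedean : ∀ ε → 0ℚ < ε → ∀ K → ∃ λ N → ι (+ K) < ε * ι (+ N)
  archimedean ε@(mkℚ +[1+ a ] d _) _ K = suc d ℕ.* suc K , (begin-strict
    ι (+ K)                                  <⟨ ι-mono-< (ℤ.+<+ (ℕP.n<1+n K)) ⟩
    ι (+ suc K)                              ≤⟨ ι-mono-≤ (ℤ.+≤+ (ℕP.m≤n*m (suc K) (suc a))) ⟩
    ι (+ (suc a ℕ.* suc K))                  ≡⟨ ι-ℕ-* (suc a) (suc K) ⟩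
    ι (+ suc a) * ι (+ suc K)                ≡⟨ cong (_* ι (+ suc K)) (*-denominator ε) ⟨
    (ε * ι (+ suc d)) * ι (+ suc K)          ≡⟨ ℚP.*-assoc ε (ι (+ suc d)) (ι (+ suc K)) ⟩
    ε * (ι (+ suc d) * ι (+ suc K))          ≡⟨ cong (ε *_) (ι-ℕ-* (suc d) (suc K)) ⟨
    ε * ι (+ (suc d ℕ.* suc K))              ∎)
    where open ℚP.≤-Reasoning
  archimedean ε@(mkℚ +0 _ _) ε>0 K = ⊥-elim (ℚP.<-irrefl (sym (ℚP.↥p≡0⇒p≡0 ε refl)) ε>0)
  archimedean ε@(mkℚ -[1+ _ ] _ _) ε>0 K = ⊥-elim (ℚP.<-asym ε>0 (ℚP.negative⁻¹ ε))

  halfPow-pos : ∀ t → 0ℚ < halfPow t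
  halfPow-pos zero = toWitness {a? = 0ℚ ℚP.<? 1ℚ} _
  halfPow-pos (suc t) = *-pos ½-pos (halfPow-pos t)

  halfPow-*-2^ : ∀ t → halfPow t * ι (+ (2 ^ t)) ≡ 1ℚ
  halfPow-*-2^ zero = refl
  halfPow-*-2^ (suc t) = begin
    (½ * halfPow t) * ι (+ (2 ℕ.* 2 ^ t))          ≡⟨ cong (½ * halfPow t *_) (ι-ℕ-* 2 (2 ^ t)) ⟩
    (½ * halfPow t) * (ι (+ 2) * ι (+ (2 ^ t)))    ≡⟨ swap ½ (halfPow t) (ι (+ 2)) (ι (+ (2 ^ t))) ⟩
    (½ * ι (+ 2)) * (halfPow t * ι (+ (2 ^ t)))    ≡⟨ cong (½ * ι (+ 2) *_) (halfPow-*-2^ t) ⟩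
    1ℚ                                             ∎
    where
    open ≡-Reasoning
    swap : ∀ a b c d → (a * b) * (c * d) ≡ (a * c) * (b * d)
    swap = solve 4 (λ a b c d → (a :* b) :* (c :* d) := (a :* c) :* (b :* d)) refl
      where open +-*-Solver

  n<2^n : ∀ n → n ℕ.< 2 ^ n
  n<2^n zero = s≤s z≤n
  n<2^n (suc n) =
    ℕP.≤-trans (s≤s (n<2^n n)) (ℕP.m<m+n (2 ^ n) (ℕP.<-≤-trans (ℕP.m^n>0 2 n) (ℕP.m≤m+n (2 ^ n) 0)))

  halfPow-scaled-null : ∀ K → Null (λ t → halfPow t * ι (+ K))
  halfPow-scaled-null K ε ε>0 with archimedean ε ε>0 K
  ... | N , K<εN = N , λ t N≤t → begin-strict
    halfPow t * ι (+ K)                 <⟨ ℚP.*-monoʳ-<-pos (halfPow t) {{positive (halfPow-pos t)}} K<εN ⟩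
    halfPow t * (ε * ι (+ N))
      ≤⟨ ℚP.*-monoˡ-≤-nonNeg (halfPow t) {{nonNegative (ℚP.<⇒≤ (halfPow-pos t))}}
           (ℚP.*-monoˡ-≤-nonNeg ε {{nonNegative (ℚP.<⇒≤ ε>0)}}
             (ι-mono-≤ (ℤ.+≤+ (ℕP.≤-trans N≤t (ℕP.<⇒≤ (n<2^n t)))))) ⟩
    halfPow t * (ε * ι (+ (2 ^ t)))     ≡⟨ rotate (halfPow t) ε (ι (+ (2 ^ t))) ⟩
    ε * (halfPow t * ι (+ (2 ^ t)))     ≡⟨ cong (ε *_) (halfPow-*-2^ t) ⟩
    ε * 1ℚ                              ≡⟨ ℚP.*-identityʳ ε ⟩
    ε                                   ∎
    where
    open ℚP.≤-Reasoning
    rotate : ∀ a b c → a * (b * c) ≡ b * (a * c)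
    rotate = solve 3 (λ a b c → a :* (b :* c) := b :* (a :* c)) refl
      where open +-*-Solver

  null-halving : ∀ {e u : ℕ → ℚ} K → (∀ J → e J ≤ ι (+ K)) →
                 (∀ J → e (suc J) ≡ ½ * (e J + u J)) → Null u → Null e
  null-halving {e} {u} K e≤K e-suc u→0 ε ε>0 = T ℕ.+ M , λ J T+M≤J → begin-strict
    e J                                  ≡⟨ cong e (ℕP.m∸n+n≡m (ℕP.≤-trans (ℕP.m≤n+m M T) T+M≤J)) ⟨
    e (J ℕ.∸ M ℕ.+ M)                    ≤⟨ tail (J ℕ.∸ M) ⟩
    halfPow (J ℕ.∸ M) * ι (+ K) + ½ * ε  <⟨ ℚP.+-monoˡ-< (½ * ε) (hK< (J ℕ.∸ M) (ℕP.m+n≤o⇒m≤o∸n T T+M≤J)) ⟩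
    ½ * ε + ½ * ε                        ≡⟨ halves ε ⟩
    ε                                    ∎
    where
    open ℚP.≤-Reasoning
    M = proj₁ (u→0 (½ * ε) (half-pos ε>0))
    u< = proj₂ (u→0 (½ * ε) (half-pos ε>0))
    T = proj₁ (halfPow-scaled-null K (½ * ε) (half-pos ε>0))
    hK< = proj₂ (halfPow-scaled-null K (½ * ε) (half-pos ε>0))
    regroup : ∀ x k ε → ½ * ((x * k + ½ * ε) + ½ * ε) ≡ (½ * x) * k + ½ * ε
    regroup = solve 3 (λ x k ε → con ½ :* ((x :* k :+ con ½ :* ε) :+ con ½ :* ε)
                              := (con ½ :* x) :* k :+ con ½ :* ε) refl
      where open +-*-Solver
    tail : ∀ t → e (t ℕ.+ M) ≤ halfPow t * ι (+ K) + ½ * ε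
    tail zero = begin
      e M                    ≤⟨ e≤K M ⟩
      ι (+ K)                ≡⟨ ℚP.+-identityʳ (ι (+ K)) ⟨
      ι (+ K) + 0ℚ           ≤⟨ ℚP.+-monoʳ-≤ (ι (+ K)) (ℚP.<⇒≤ (half-pos ε>0)) ⟩
      ι (+ K) + ½ * ε        ≡⟨ cong (_+ ½ * ε) (ℚP.*-identityˡ (ι (+ K))) ⟨
      1ℚ * ι (+ K) + ½ * ε   ∎
    tail (suc t) = begin
      e (suc (t ℕ.+ M))                              ≡⟨ e-suc (t ℕ.+ M) ⟩
      ½ * (e (t ℕ.+ M) + u (t ℕ.+ M))
        ≤⟨ ℚP.*-monoˡ-≤-nonNeg ½ {{nonNegative (ℚP.<⇒≤ ½-pos)}}
             (ℚP.+-mono-≤ (tail t) (ℚP.<⇒≤ (u< (t ℕ.+ M) (ℕP.m≤n+m M t)))) ⟩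
      ½ * ((halfPow t * ι (+ K) + ½ * ε) + ½ * ε)
        ≡⟨ regroup (halfPow t) (ι (+ K)) ε ⟩
      (½ * halfPow t) * ι (+ K) + ½ * ε
        ∎

  null-window : ∀ m (G : ℕ → ℕ → ℚ) d → (∀ e → e ℕ.≤ d → Null (λ J → G J e)) →
                Null (λ J → ℚW.window m (G J) d)
  null-window zero G d G→0 = G→0 d ℕP.≤-refl
  null-window (suc m) G zero G→0 = null-cong (λ J → sym (ℚW.window-at-0 (suc m) (G J))) (G→0 0 z≤n)
  null-window (suc m) G (suc d) G→0 = null-cong (λ J → sym (ℚW.window-suc-suc m (G J) d))
    (null-+ (G→0 (suc d) ℕP.≤-refl) (null-window m G d (λ e e≤d → G→0 e (ℕP.m≤n⇒m≤1+n e≤d))))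

module Series (m′ : ℕ) where

  open import Data.Integer as ℤ using (+_)
  open import Data.Rational as ℚ using (ℚ; 0ℚ; 1ℚ; ½; _+_; _*_; _-_; -_; _≤_)
  open import Data.Rational.Solver using (module +-*-Solver)
  open import Data.Nat.Induction using (<-rec)
  open Coefficients
  open Embedding
  open Recurrence

  m : ℕ
  m = suc m′

  δ₀ : ℕ → ℚ
  δ₀ zero = 1ℚ
  δ₀ (suc _) = 0ℚ

  step : (ℕ → ℚ) → ℕ → ℚ
  step X d = δ₀ d + ½ * ℚW.window m X d

  S : ℕ → ℕ → ℚ
  S J d = partialSum (λ j → ι (+ binom m j d) * halfPow j) J

  S-suc : ∀ J d → S (suc J) d ≡ step (S J) d
  S-suc zero d = begin
    0ℚ + ι (+ binom m 0 d) * 1ℚ        ≡⟨ cancel (ι (+ binom m 0 d)) ⟩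
    ι (+ binom m 0 d)                  ≡⟨ impulse d ⟩
    δ₀ d                               ≡⟨ cancel′ (δ₀ d) ⟨
    δ₀ d + ½ * 0ℚ                      ≡⟨ cong (λ w → δ₀ d + ½ * w) window-of-0 ⟨
    step (S 0) d                       ∎
    where
    open ≡-Reasoning
    cancel : ∀ x → 0ℚ + x * 1ℚ ≡ x
    cancel = solve 1 (λ x → con 0ℚ :+ x :* con 1ℚ := x) refl
      where open +-*-Solver
    cancel′ : ∀ x → x + ½ * 0ℚ ≡ x
    cancel′ = solve 1 (λ x → x :+ con ½ :* con 0ℚ := x) refl
      where open +-*-Solver
    impulse : ∀ d → ι (+ binom m 0 d) ≡ δ₀ d
    impulse zero = refl
    impulse (suc d) = refl
    window-of-0 : ℚW.window m (λ _ → 0ℚ) d ≡ 0ℚ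
    window-of-0 = ℚW.window-preserves (_≡ 0ℚ) (λ x≡0 y≡0 → cong₂ _+_ x≡0 y≡0) m _ d (λ _ _ → refl)
  S-suc (suc J) d = begin
    S (suc J) d + ι (+ binom m (suc J) d) * (½ * h)   ≡⟨ cong₂ (λ s b → s + ι (+ b) * (½ * h))
                                                           (S-suc J d) (binom-suc m J d) ⟩
    step (S J) d + ι (+ b) * (½ * h)                  ≡⟨ factor (δ₀ d) w (ι (+ b)) h ⟩
    δ₀ d + ½ * (w + ι (+ b) * h)                      ≡⟨ cong (λ x → δ₀ d + ½ * (w + x)) new-term ⟩
    δ₀ d + ½ * (w + ℚW.window m (λ e → ι (+ binom m J e) * h) d)
                                                      ≡⟨ cong (λ x → δ₀ d + ½ * x) (ℚW.window-∙ m (S J) _ d) ⟨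
    step (S (suc J)) d                                ∎
    where
    open ≡-Reasoning
    h = halfPow J
    w = ℚW.window m (S J) d
    b = ℕW.window m (binom m J) d
    factor : ∀ δ w b h → (δ + ½ * w) + b * (½ * h) ≡ δ + ½ * (w + b * h)
    factor = solve 4 (λ δ w b h → (δ :+ con ½ :* w) :+ b :* (con ½ :* h) := δ :+ con ½ :* (w :+ b :* h)) refl
      where open +-*-Solver
    scaled-+ : ∀ x y → ι (+ (x ℕ.+ y)) * h ≡ ι (+ x) * h + ι (+ y) * h
    scaled-+ x y = trans (cong (_* h) (trans (cong ι (ℤP.pos-+ x y)) (ι-+ (+ x) (+ y))))
                         (ℚP.*-distribʳ-+ h (ι (+ x)) (ι (+ y)))
    new-term : ι (+ b) * h ≡ ℚW.window m (λ e → ι (+ binom m J e) * h) d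
    new-term = window-map ℕP.+-0-isCommutativeMonoid ℚP.+-0-isCommutativeMonoid
                 (λ b → ι (+ b) * h) scaled-+ m (binom m J) d

  step-minus : ∀ X Y d → step X d - step Y d ≡ ½ * ℚW.window m (λ e → X e - Y e) d
  step-minus X Y d = begin
    step X d - step Y d                                  ≡⟨ factor (δ₀ d) (ℚW.window m X d) (ℚW.window m Y d) ⟩
    ½ * (ℚW.window m X d + - ℚW.window m Y d)            ≡⟨ cong (λ w → ½ * (ℚW.window m X d + w)) negated ⟩
    ½ * (ℚW.window m X d + ℚW.window m (λ e → - Y e) d)  ≡⟨ cong (½ *_) (ℚW.window-∙ m X (λ e → - Y e) d) ⟨
    ½ * ℚW.window m (λ e → X e - Y e) d                  ∎
    where
    open ≡-Reasoning
    factor : ∀ δ x y → (δ + ½ * x) - (δ + ½ * y) ≡ ½ * (x + - y)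
    factor = solve 3 (λ δ x y → (δ :+ con ½ :* x) :- (δ :+ con ½ :* y) := con ½ :* (x :+ :- y)) refl
      where open +-*-Solver
    negated : - ℚW.window m Y d ≡ ℚW.window m (λ e → - Y e) d
    negated = window-map ℚP.+-0-isCommutativeMonoid ℚP.+-0-isCommutativeMonoid -_ ℚP.neg-distrib-+ m Y d

  S-nonNegative : ∀ J d → 0ℚ ≤ S J d
  S-nonNegative zero d = ℚP.≤-refl
  S-nonNegative (suc J) d = ℚP.+-mono-≤ (S-nonNegative J d)
    (Null.*-nonNeg (ι-nonNeg (binom m J d)) (ℚP.<⇒≤ (Null.halfPow-pos J)))

  L : ℕ → ℚ
  L d = ι (+ 2 ℤ.* f m d)

  L-step : ∀ d → L d ≡ step L d
  L-step zero = sym (cong (λ w → 1ℚ + ½ * w) (ℚW.window-at-0 m L))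
  L-step (suc d) = begin
    L (suc d)                                            ≡⟨ halve (L (suc d)) ⟩
    0ℚ + ½ * (L (suc d) + L (suc d))                     ≡⟨ cong (λ w → 0ℚ + ½ * (L (suc d) + ι (+ 2 ℤ.* w)))
                                                              (f-suc m′ d) ⟩
    0ℚ + ½ * (L (suc d) + ι (+ 2 ℤ.* ℤW.window m′ (f m) d)) ≡⟨ cong (λ w → 0ℚ + ½ * (L (suc d) + w)) doubled ⟩
    0ℚ + ½ * (L (suc d) + ℚW.window m′ L d)              ≡⟨ cong (λ w → 0ℚ + ½ * w) (ℚW.window-suc-suc m′ L d) ⟨
    step L (suc d)                                       ∎
    where
    open ≡-Reasoning
    halve : ∀ x → x ≡ 0ℚ + ½ * (x + x)
    halve = solve 1 (λ x → x := con 0ℚ :+ con ½ :* (x :+ x)) refl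
      where open +-*-Solver
    doubled-+ : ∀ x y → ι (+ 2 ℤ.* (x ℤ.+ y)) ≡ ι (+ 2 ℤ.* x) + ι (+ 2 ℤ.* y)
    doubled-+ x y = trans (cong ι (ℤP.*-distribˡ-+ (+ 2) x y)) (ι-+ (+ 2 ℤ.* x) (+ 2 ℤ.* y))
    doubled : ι (+ 2 ℤ.* ℤW.window m′ (f m) d) ≡ ℚW.window m′ L d
    doubled = window-map ℤP.+-0-isCommutativeMonoid ℚP.+-0-isCommutativeMonoid
                (λ z → ι (+ 2 ℤ.* z)) doubled-+ m′ (f m) d

  E : ℕ → ℕ → ℚ
  E J d = L d - S J d

  E-suc : ∀ J d → E (suc J) d ≡ ½ * ℚW.window m (E J) d
  E-suc J d = trans (cong₂ _-_ (L-step d) (S-suc J d)) (step-minus L (S J) d)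

  L-natural : ∀ d → L d ≡ ι (+ (2 ℕ.* ℤ.∣ f m d ∣))
  L-natural d = cong ι (trans (cong (+ 2 ℤ.*_) (sym (ℤP.0≤i⇒+∣i∣≡i (f-nonNegative m′ d))))
                              (sym (ℤP.pos-* 2 ℤ.∣ f m d ∣)))

  E-≤-L : ∀ J d → E J d ≤ L d
  E-≤-L J d =
    subst (E J d ≤_) (ℚP.+-identityʳ (L d)) (ℚP.+-monoʳ-≤ (L d) (ℚP.neg-antimono-≤ (S-nonNegative J d)))

  E-nonNegative : ∀ J d → 0ℚ ≤ E J d
  E-nonNegative zero d = subst (0ℚ ≤_) (trans (sym (L-natural d)) (sym (ℚP.+-identityʳ (L d))))
                                       (ι-nonNeg (2 ℕ.* ℤ.∣ f m d ∣))
  E-nonNegative (suc J) d = subst (0ℚ ≤_) (sym (E-suc J d)) (Null.*-nonNeg (ℚP.<⇒≤ Null.½-pos)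
    (ℚW.window-preserves (0ℚ ≤_) ℚP.+-mono-≤ m (E J) d (λ e _ → E-nonNegative J e)))

  ∣S-L∣≡E : ∀ J d → ℚ.∣ S J d - L d ∣ ≡ E J d
  ∣S-L∣≡E J d = begin
    ℚ.∣ S J d - L d ∣      ≡⟨ cong ℚ.∣_∣ (flip (S J d) (L d)) ⟩
    ℚ.∣ - E J d ∣          ≡⟨ ℚP.∣-p∣≡∣p∣ (E J d) ⟩
    ℚ.∣ E J d ∣            ≡⟨ ℚP.0≤p⇒∣p∣≡p (E-nonNegative J d) ⟩
    E J d                  ∎
    where
    open ≡-Reasoning
    flip : ∀ x y → x - y ≡ - (y - x)
    flip = solve 2 (λ x y → x :- y := :- (y :- x)) refl
      where open +-*-Solver

  E-null : ∀ d → Null.Null (λ J → E J d)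
  E-null = <-rec (λ d → Null.Null (λ J → E J d)) null
    where
    bounded : ∀ d J → E J d ≤ ι (+ (2 ℕ.* ℤ.∣ f m d ∣))
    bounded d J = subst (E J d ≤_) (L-natural d) (E-≤-L J d)
    null : ∀ d → (∀ {e} → e ℕ.< d → Null.Null (λ J → E J e)) → Null.Null (λ J → E J d)
    null zero _ = Null.null-halving (2 ℕ.* ℤ.∣ f m 0 ∣) (bounded 0) halving Null.null-0
      where
      halving : ∀ J → E (suc J) 0 ≡ ½ * (E J 0 + 0ℚ)
      halving J = trans (E-suc J 0) (cong (½ *_) (trans (ℚW.window-at-0 m (E J)) (sym (ℚP.+-identityʳ (E J 0)))))
    null (suc d) below = Null.null-halving (2 ℕ.* ℤ.∣ f m (suc d) ∣) (bounded (suc d)) halving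
        (Null.null-window m′ E d (λ e e≤d → below (s≤s e≤d)))
      where
      halving : ∀ J → E (suc J) (suc d) ≡ ½ * (E J (suc d) + ℚW.window m′ (E J) d)
      halving J = trans (E-suc J (suc d)) (cong (½ *_) (ℚW.window-suc-suc m′ (E J) d))

module PartialSums (m′ n : ℕ) where

  open import Data.Nat using (_+_; _*_; _≤_; _<_)
  open import Data.Nat.Divisibility using (_∣_; _∣?_; divides; quotient)
  open _∣_ using (equality)
  open import Data.Integer as ℤ using (+_)
  open import Data.Rational as ℚ using (0ℚ)
  open import Data.Product using (∃; _×_; _,_)
  open import Data.Sum using (inj₁; inj₂)
  open import Data.Empty using (⊥-elim)
  open import Relation.Nullary using (¬_; yes; no)
  open Coefficients
  open Embedding
  open Series m′

  term-divisible : ∀ k (m∣n+k : m ∣ n + k) →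
                   term m n k ≡ ι (+ binom m (quotient m∣n+k) k) ℚ.* halfPow (quotient m∣n+k)
  term-divisible k m∣n+k with m ∣? (n + k)
  ... | yes m∣n+k′ = cong (λ q → ι (+ binom m q k) ℚ.* halfPow q)
          (ℕP.*-cancelʳ-≡ (quotient m∣n+k′) (quotient m∣n+k) m
            (trans (sym (equality m∣n+k′)) (equality m∣n+k)))
  ... | no m∤n+k = ⊥-elim (m∤n+k m∣n+k)

  term-indivisible : ∀ k → ¬ m ∣ n + k → term m n k ≡ 0ℚ
  term-indivisible k m∤n+k with m ∣? (n + k)
  ... | yes m∣n+k = ⊥-elim (m∤n+k m∣n+k)
  ... | no _ = refl

  S-vanishes : ∀ J → J * m < n + m → S J n ≡ 0ℚ
  S-vanishes zero _ = refl
  S-vanishes (suc J) [1+J]m<n+m = begin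
    S J n ℚ.+ ι (+ binom m J n) ℚ.* halfPow J   ≡⟨ cong₂ (λ s b → s ℚ.+ ι (+ b) ℚ.* halfPow J)
                                                      (S-vanishes J Jm<n+m) binom≡0 ⟩
    0ℚ ℚ.+ 0ℚ ℚ.* halfPow J                     ≡⟨ cong (0ℚ ℚ.+_) (ℚP.*-zeroˡ (halfPow J)) ⟩
    0ℚ                                          ∎
    where
    open ≡-Reasoning
    Jm<n : J * m < n
    Jm<n = ℕP.+-cancelˡ-< m (J * m) n (subst (m + J * m <_) (ℕP.+-comm n m) [1+J]m<n+m)
    Jm<n+m : J * m < n + m
    Jm<n+m = ℕP.<-≤-trans Jm<n (ℕP.m≤m+n n m)
    binom≡0 : binom m J n ≡ 0
    binom≡0 = ℕW.Palindromic.vanishesAbove (binom-palindromic m J) n Jm<n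

  least-multiple-above : ∀ t → ∃ λ J → t ≤ J * m × J * m < t + m
  least-multiple-above zero = 0 , z≤n , s≤s z≤n
  least-multiple-above (suc t) with least-multiple-above t
  ... | J , t≤Jm , Jm<t+m with ℕP.m≤n⇒m<n∨m≡n t≤Jm
  ...   | inj₁ t<Jm = J , t<Jm , ℕP.<-trans Jm<t+m (ℕP.n<1+n (t + m))
  ...   | inj₂ t≡Jm = suc J , s≤s (ℕP.≤-trans (ℕP.≤-reflexive t≡Jm) (ℕP.m≤n+m (J * m) m′))
                      , s≤s (ℕP.≤-reflexive (trans (cong (λ x → suc (m′ + x)) (sym t≡Jm))
                                                     (trans (cong suc (ℕP.+-comm m′ t)) (sym (ℕP.+-suc t m′)))))

  record Tracking (K : ℕ) : Set where
    field
      J            : ℕ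
      partialSum≡S : partialSum (term m n) K ≡ S J n
      above        : n + K ≤ J * m
      below        : J * m < n + K + m

  tracking-start : Tracking 0
  tracking-start with least-multiple-above n
  ... | J , n≤Jm , Jm<n+m = record
    { J            = J
    ; partialSum≡S = sym (S-vanishes J Jm<n+m)
    ; above        = subst (_≤ J * m) (sym (ℕP.+-identityʳ n)) n≤Jm
    ; below        = subst (λ x → J * m < x + m) (sym (ℕP.+-identityʳ n)) Jm<n+m
    }

  n+K+m<n+[1+K]+m : ∀ K → n + K + m < n + suc K + m
  n+K+m<n+[1+K]+m K = ℕP.+-monoˡ-< m (ℕP.+-monoʳ-< n (ℕP.n<1+n K))

  tracking-divisible : ∀ {K} → Tracking K → m ∣ n + K → Tracking (suc K)
  tracking-divisible {K} T m∣n+K = record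
    { J            = suc J
    ; partialSum≡S = begin
        partialSum (term m n) K ℚ.+ term m n K      ≡⟨ cong₂ ℚ._+_ partialSum≡S (term-divisible K m∣n+K) ⟩
        S J n ℚ.+ ι (+ binom m q K) ℚ.* halfPow q   ≡⟨ cong (λ j → S J n ℚ.+ ι (+ binom m j K) ℚ.* halfPow j)
                                                          (sym J≡q) ⟩
        S J n ℚ.+ ι (+ binom m J K) ℚ.* halfPow J   ≡⟨ cong (λ b → S J n ℚ.+ ι (+ b) ℚ.* halfPow J)
                                                          binom-mirror ⟩
        S (suc J) n                                 ∎
    ; above        = subst (_≤ suc J * m) (sym (ℕP.+-suc n K))
                       (s≤s (ℕP.≤-trans (ℕP.≤-reflexive n+K≡Jm) (ℕP.m≤n+m (J * m) m′)))
    ; below        = subst (_< n + suc K + m) (trans (ℕP.+-comm (n + K) m) (cong (λ x → m + x) n+K≡Jm))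
                       (n+K+m<n+[1+K]+m K)
    }
    where
    open Tracking T
    open ≡-Reasoning
    q = quotient m∣n+K
    n+K≡qm : n + K ≡ q * m
    n+K≡qm = equality m∣n+K
    J≡q : J ≡ q
    J≡q = ℕP.≤-antisym
      (ℕP.≤-pred (ℕP.*-cancelʳ-< m J (suc q)
        (subst (J * m <_) (trans (cong (_+ m) n+K≡qm) (ℕP.+-comm (q * m) m)) below)))
      (ℕP.*-cancelʳ-≤ q J m (subst (_≤ J * m) n+K≡qm above))
    n+K≡Jm : n + K ≡ J * m
    n+K≡Jm = trans n+K≡qm (cong (_* m) (sym J≡q))
    binom-mirror : binom m J K ≡ binom m J n
    binom-mirror = ℕW.Palindromic.mirror (binom-palindromic m J) K n (trans (ℕP.+-comm K n) n+K≡Jm)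

  tracking-indivisible : ∀ {K} → Tracking K → ¬ m ∣ n + K → Tracking (suc K)
  tracking-indivisible {K} T m∤n+K = record
    { J            = J
    ; partialSum≡S = trans (cong₂ ℚ._+_ partialSum≡S (term-indivisible K m∤n+K)) (ℚP.+-identityʳ (S J n))
    ; above        = subst (_≤ J * m) (sym (ℕP.+-suc n K))
                       (ℕP.≤∧≢⇒< above (λ n+K≡Jm → m∤n+K (divides J n+K≡Jm)))
    ; below        = ℕP.<-trans below (n+K+m<n+[1+K]+m K)
    }
    where open Tracking T

  tracking : ∀ K → Tracking K
  tracking zero = tracking-start
  tracking (suc K) with m ∣? (n + K)
  ... | yes m∣n+K = tracking-divisible (tracking K) m∣n+K
  ... | no m∤n+K  = tracking-indivisible (tracking K) m∤n+K

open import Data.Nat using (_≤_)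
open import Data.Integer using (+_; _*_)
open import Data.Rational as ℚ using (_/_)
open import Data.Product using (∃; _,_)

mainTheorem5 : (m : ℕ) → 1 ≤ m → (n : ℕ) →
    SeriesConvergesTo (term m n) (((+ 2) * f m n) / 1)
mainTheorem5 (suc m′) _ n ε ε>0 = converge (E-null n ε ε>0)
  where
  open Series m′
  open PartialSums m′ n
  open ℚP.≤-Reasoning
  converge : (∃ λ M → ∀ J → M ≤ J → E J n ℚ.< ε) →
             ∃ λ N → ∀ K → N ≤ K → ℚ.∣ partialSum (term m n) K ℚ.- L n ∣ ℚ.< ε
  converge (M , E<ε) = M ℕ.* m , λ K Mm≤K → let open Tracking (tracking K) in begin-strict
    ℚ.∣ partialSum (term m n) K ℚ.- L n ∣    ≡⟨ cong (λ s → ℚ.∣ s ℚ.- L n ∣) partialSum≡S ⟩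
    ℚ.∣ S J n ℚ.- L n ∣                      ≡⟨ ∣S-L∣≡E J n ⟩
    E J n                                    <⟨ E<ε J (ℕP.*-cancelʳ-≤ M J m
                                                  (ℕP.≤-trans Mm≤K (ℕP.≤-trans (ℕP.m≤n+m K n) above))) ⟩
    ε                                        ∎
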